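{- Let $n\ge 1$ and $r\ge 2$ be integers. For $\mathbf{m}=(m_1,\dots,m_n)\in\mathbb{N}^n$ let $g_r(\mathbf{m};t)=\sum_{w} t^{\alpha(w)}$, the sum over all words $w$ over the alphabet $\{1,\dots,n\}$ with exactly $m_i$ copies of letter $i$ for each $i$, where $\alpha(w)$ is the number of indices $i$ with $w_i<w_{i+1}<\dots<w_{i+r-1}$ (occurrences of the consecutive pattern $12\cdots r$); set $g_r(\mathbf{m};t)=0$ if some coordinate of $\mathbf{m}$ is negative. Define polynomials $P^{(r)}_k(t)$ by $P^{(r)}_k(t)=0$ for $1\le k<r$, $P^{(r)}_r(t)=t-1$, and $P^{(r)}_k(t)=(t-1)\sum_{i=1}^{r-1}P^{(r)}_{k-i}(t)$ for $k>r$. For $1\le k\le n$ let $V_k$ be the set of $0$-$1$ vectors of length $n$ with exactly $k$ ones. Then for every $\mathbf{m}\in\mathbb{N}^n$ with $\mathbf{m}\neq(0,\dots,0)$, $$g_r(\mathbf{m};t)=\sum_{\mathbf{v}\in V_1} g_r(\mathbf{m}-\mathbf{v};t)+\sum_{k=r}^{n}\sum_{\mathbf{v}\in V_k}P^{(r)}_k(t)\,g_r(\mathbf{m}-\mathbf{v};t).$$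
   Context: Words are finite sequences of letters from $\{1,\dots,n\}$; the empty word is the unique word with $\mathbf{m}=(0,\dots,0)$, so $g_r(\mathbf{0};t)=1$. -}

module Defs where

open import Level using (Level)
open import Algebra.Bundles using (CommutativeRing)
open import Data.Nat as ℕ using (ℕ; zero; suc; _<?_; _≟_)
open import Data.Integer as ℤ using (ℤ; +_; -[1+_])
open import Data.Bool using (Bool; true; false; _∧_; if_then_else_)
open import Data.Fin as Fin using (Fin)
open import Data.Fin.Properties as FinP using ()
open import Data.List as List using (List; []; _∷_; filter; map; concatMap; take; upTo)
open import Data.Vec as Vec using (Vec; []; _∷_)
open import Data.Vec.Properties using (≡-dec)
open import Data.Maybe using (Maybe; just; nothing)
open import Relation.Nullary.Decidable using (⌊_⌋; yes; no)
open import Relation.Binary.PropositionalEquality using (_≡_)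

-- Words over the alphabet {1,…,n} are lists of elements of Fin n
-- (letter i+1 is represented by Fin element i; order is preserved).

allWords : (n len : ℕ) → List (List (Fin n))
allWords n zero = [] ∷ []
allWords n (suc len) = concatMap (λ w → map (λ a → a ∷ w) (List.allFin n)) (allWords n len)

content : {n : ℕ} → List (Fin n) → Vec ℕ n
content {n} [] = Vec.replicate n 0
content (a ∷ w) = Vec.updateAt (content w) a suc

incRun : {n : ℕ} → ℕ → List (Fin n) → Bool
incRun zero _ = true
incRun (suc zero) (x ∷ _) = true
incRun (suc (suc k)) (x ∷ y ∷ rest) = ⌊ x Fin.<? y ⌋ ∧ incRun (suc k) (y ∷ rest)
incRun _ _ = false

alpha : {n : ℕ} → ℕ → List (Fin n) → ℕ
alpha r [] = 0
alpha r (x ∷ w) = (if incRun r (x ∷ w) then 1 else 0) ℕ.+ alpha r w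

allBoolVecs : (n : ℕ) → List (Vec Bool n)
allBoolVecs zero = [] ∷ []
allBoolVecs (suc n) = concatMap (λ v → (false ∷ v) ∷ (true ∷ v) ∷ []) (allBoolVecs n)

ones : {n : ℕ} → Vec Bool n → ℕ
ones [] = 0
ones (b ∷ v) = (if b then 1 else 0) ℕ.+ ones v

V : (n k : ℕ) → List (Vec Bool n)
V n k = filter (λ v → ones v ≟ k) (allBoolVecs n)

minus : {n : ℕ} → Vec ℕ n → Vec Bool n → Vec ℤ n
minus = Vec.zipWith (λ a b → (+ a) ℤ.- (if b then ℤ.1ℤ else ℤ.0ℤ))

natVec? : {n : ℕ} → Vec ℤ n → Maybe (Vec ℕ n)
natVec? [] = just []
natVec? (+ a ∷ v) with natVec? v
... | just u = just (a ∷ u)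
... | nothing = nothing
natVec? (-[1+ _ ] ∷ v) = nothing

sumℕ : {n : ℕ} → Vec ℕ n → ℕ
sumℕ = Vec.foldr _ ℕ._+_ 0

module Poly {c ℓ : Level} (R : CommutativeRing c ℓ) where
  open CommutativeRing R

  sumR : List Carrier → Carrier
  sumR = List.foldr _+_ 0#

  pow : Carrier → ℕ → Carrier
  pow t zero = 1#
  pow t (suc k) = t * pow t k

  g : {n : ℕ} → (r : ℕ) → Vec ℕ n → Carrier → Carrier
  g {n} r m t =
    sumR (map (λ w → pow t (alpha r w))
              (filter (λ w → ≡-dec ℕ._≟_ (content w) m) (allWords n (sumℕ m))))

  gℤ : {n : ℕ} → (r : ℕ) → Vec ℤ n → Carrier → Carrier
  gℤ r m t with natVec? m
  ... | just u = g r u t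
  ... | nothing = 0#

  -- history [P_k, P_{k-1}, …, P_1] of the sequence P^{(r)}
  Phist : (r : ℕ) → Carrier → ℕ → List Carrier
  Phist r t zero = []
  Phist r t (suc k) = new ∷ hist
    where
    hist = Phist r t k
    new : Carrier
    new with suc k <? r
    ... | yes _ = 0#
    ... | no _ with suc k ≟ r
    ...   | yes _ = t - 1#
    ...   | no _ = (t - 1#) * sumR (take (r ℕ.∸ 1) hist)

  -- P^{(r)}_k(t) for k ≥ 1 (value at k = 0 is irrelevant, set to 0)
  P : (r : ℕ) → ℕ → Carrier → Carrier
  P r k t with Phist r t k
  ... | [] = 0#
  ... | x ∷ _ = x

range : (r n : ℕ) → List ℕ
range r n = map (r ℕ.+_) (upTo (suc n ℕ.∸ r))

module Submission where

-- Cut every word w of content m ≠ 0 after its first, maximal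
-- increasing run, of length L.  The occurrences inside that run contribute
-- t^{(L+1) ∸ r}, and the recursion defining P^{(r)} says precisely that
--   t^{(L+1) ∸ r} = ∑_{k=1}^{L} c_k t^{(L-k+1) ∸ r},   c_1 = 1, c_k = P^{(r)}_k.
-- Hence t^{α(w)} = ∑_k c_k [w starts increasing for k letters] t^{α(drop k w)}.
-- Summing over w, the increasing prefix u of length k ranges over the
-- increasing words, i.e. over the 0-1 vectors v ∈ V_k (u ↔ content u), and
-- the suffix ranges over the words of content m - v, giving g_r(m - v).

open import Defs
open import Level using (Level)
open import Algebra.Bundles using (CommutativeRing)
open import Data.Nat using (ℕ; _≤_)
open import Data.List using (map)
open import Data.Vec using (Vec; replicate)
open import Relation.Binary.PropositionalEquality using (_≡_)
open import Relation.Nullary using (¬_)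

open import Data.Nat as ℕ using (zero; suc; _∸_; _<_; z≤n; s≤s)
import Data.Nat.Properties as ℕP
open import Data.Nat.Induction using (<-rec)
open import Data.Integer as ℤ using (ℤ)
import Data.Integer.Properties as ℤP
open import Data.List as List using (List; []; _∷_; _++_; drop; length)
import Data.List.Properties as ListP
open import Data.Bool using (Bool; true; false; _∧_; if_then_else_)
open import Data.Fin as Fin using (Fin)
import Data.Fin.Properties as FinP
open import Data.Vec as Vec using ([]; _∷_; lookup; updateAt; zipWith)
import Data.Vec.Properties as VecP
open import Data.Maybe using (just; nothing)
open import Data.Product using (Σ; _×_; _,_; proj₂)
open import Data.Sum using (inj₁; inj₂)
open import Data.Empty using (⊥-elim)
open import Data.List.Membership.Propositional using (_∈_)
open import Data.List.Relation.Unary.Any using (here; there)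
open import Relation.Nullary using (Dec; yes; no)
open import Relation.Nullary.Decidable using (⌊_⌋)
import Relation.Binary.PropositionalEquality as Eq

-- Combinatorics of words, contents and 0-1 vectors (no ring involved).
module WordCombinatorics where
  open Eq using (refl; sym; trans; cong; cong₂)
  open import Data.Nat using (_+_)

  runAfter : {n : ℕ} → Fin n → List (Fin n) → ℕ
  runAfter x [] = 0
  runAfter x (y ∷ w) with x Fin.<? y
  ... | yes _ = suc (runAfter y w)
  ... | no _ = 0

  runLen : {n : ℕ} → List (Fin n) → ℕ
  runLen [] = 0
  runLen (x ∷ w) = suc (runAfter x w)

  runLen≤length : {n : ℕ} (w : List (Fin n)) → runLen w ≤ length w
  runLen≤length [] = z≤n
  runLen≤length (x ∷ w) = s≤s (runAfter≤length x w)
    where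
    runAfter≤length : {n : ℕ} (x : Fin n) (w : List (Fin n)) → runAfter x w ≤ length w
    runAfter≤length x [] = z≤n
    runAfter≤length x (y ∷ w) with x Fin.<? y
    ... | yes _ = s≤s (runAfter≤length y w)
    ... | no _ = z≤n

  incRun-within : {n : ℕ} (k : ℕ) (w : List (Fin n)) → k < runLen w → incRun (suc k) w ≡ true
  incRun-within zero (x ∷ w) _ = refl
  incRun-within (suc k) (x ∷ y ∷ w) k<run with x Fin.<? y
  ... | yes _ = incRun-within k (y ∷ w) (ℕP.≤-pred k<run)
  incRun-within (suc k) (x ∷ y ∷ w) (s≤s ()) | no _
  incRun-within (suc k) (x ∷ []) (s≤s ())

  incRun-beyond : {n : ℕ} (k : ℕ) (w : List (Fin n)) → runLen w ≤ k → incRun (suc k) w ≡ false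
  incRun-beyond zero [] _ = refl
  incRun-beyond (suc k) [] _ = refl
  incRun-beyond (suc k) (x ∷ []) _ = refl
  incRun-beyond (suc k) (x ∷ y ∷ w) run≤k with x Fin.<? y
  ... | yes _ = incRun-beyond k (y ∷ w) (ℕP.≤-pred run≤k)
  ... | no _ = refl

  runLen-drop : {n : ℕ} (j : ℕ) (w : List (Fin n)) → j < runLen w → runLen (drop j w) ≡ runLen w ∸ j
  runLen-drop zero w _ = refl
  runLen-drop (suc j) (x ∷ y ∷ w) j<run with x Fin.<? y
  ... | yes _ = runLen-drop j (y ∷ w) (ℕP.≤-pred j<run)
  runLen-drop (suc j) (x ∷ y ∷ w) (s≤s ()) | no _
  runLen-drop (suc j) (x ∷ []) (s≤s ())

  incRun-prefix : {n : ℕ} (j : ℕ) (u w : List (Fin n)) → length u ≡ j → incRun j (u ++ w) ≡ incRun j u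
  incRun-prefix zero u w _ = refl
  incRun-prefix (suc zero) (x ∷ []) w refl = refl
  incRun-prefix (suc (suc j)) (x ∷ y ∷ u) w refl = cong (⌊ x Fin.<? y ⌋ ∧_) (incRun-prefix (suc j) (y ∷ u) w refl)

  drop-++ : {A : Set} (u w : List A) → drop (length u) (u ++ w) ≡ w
  drop-++ [] w = refl
  drop-++ (x ∷ u) w = drop-++ u w

  -- For r ≥ 2 (written r = 2 + ρ), an increasing run of length L contains
  -- exactly (L + 1) ∸ r occurrences of the pattern 12⋯r, and no occurrence
  -- starts inside the run but ends after it; so α splits at the end of the
  -- first run.
  module _ (ρ : ℕ) where
    private
      r : ℕ
      r = 2 + ρ

      indicator : Bool → ℕ
      indicator b = if b then 1 else 0

    alpha-run : {n : ℕ} (w : List (Fin n)) →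
      alpha r w ≡ (suc (runLen w) ∸ r) + alpha r (drop (runLen w) w)
    alpha-run [] = refl
    alpha-run (x ∷ w) = alpha-run-from x w
      where
      alpha-run-from : {n : ℕ} (x : Fin n) (w : List (Fin n)) →
        alpha r (x ∷ w) ≡ (suc (runLen (x ∷ w)) ∸ r) + alpha r (drop (runLen (x ∷ w)) (x ∷ w))
      alpha-run-from x [] = cong (_+ 0) (sym (ℕP.0∸n≡0 ρ))
      alpha-run-from x (y ∷ w) with x Fin.<? y
      ... | no _ = cong (_+ alpha r (y ∷ w)) (sym (ℕP.0∸n≡0 ρ))
      ... | yes _ = begin
          indicator (incRun (suc ρ) (y ∷ w)) + alpha r (y ∷ w)
            ≡⟨ cong (indicator (incRun (suc ρ) (y ∷ w)) +_) (alpha-run-from y w) ⟩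
          indicator (incRun (suc ρ) (y ∷ w)) + ((suc L ∸ r) + β)
            ≡⟨ sym (ℕP.+-assoc (indicator (incRun (suc ρ) (y ∷ w))) _ β) ⟩
          (indicator (incRun (suc ρ) (y ∷ w)) + (suc L ∸ r)) + β
            ≡⟨ cong (_+ β) (window-count (ρ ℕ.<? L)) ⟩
          (suc (suc L) ∸ r) + β ∎
        where
        open Eq.≡-Reasoning
        L = runLen (y ∷ w)
        β = alpha r (drop L (y ∷ w))
        -- the new letter x starts an occurrence iff the run after it is long enough
        window-count : Dec (ρ < L) → indicator (incRun (suc ρ) (y ∷ w)) + (suc L ∸ r) ≡ suc (suc L) ∸ r
        window-count (yes ρ<L) rewrite incRun-within ρ (y ∷ w) ρ<L = sym (ℕP.+-∸-assoc 1 ρ<L)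
        window-count (no ρ≮L) rewrite incRun-beyond ρ (y ∷ w) (ℕP.≮⇒≥ ρ≮L) =
          trans (ℕP.m≤n⇒m∸n≡0 (ℕP.m≤n⇒m≤1+n (ℕP.≮⇒≥ ρ≮L))) (sym (ℕP.m≤n⇒m∸n≡0 (ℕP.≮⇒≥ ρ≮L)))

    alpha-drop : {n : ℕ} (j : ℕ) (w : List (Fin n)) → j ≤ runLen w →
      alpha r (drop j w) ≡ (suc (runLen w ∸ j) ∸ r) + alpha r (drop (runLen w) w)
    alpha-drop j w j≤run with ℕP.m≤n⇒m<n∨m≡n j≤run
    ... | inj₂ refl = cong (λ z → (suc z ∸ r) + alpha r (drop (runLen w) w)) (sym (ℕP.n∸n≡0 (runLen w)))
    ... | inj₁ j<run = begin
        alpha r (drop j w)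
          ≡⟨ alpha-run (drop j w) ⟩
        (suc (runLen (drop j w)) ∸ r) + alpha r (drop (runLen (drop j w)) (drop j w))
          ≡⟨ cong (λ L → (suc L ∸ r) + alpha r (drop L (drop j w))) (runLen-drop j w j<run) ⟩
        (suc (runLen w ∸ j) ∸ r) + alpha r (drop (runLen w ∸ j) (drop j w))
          ≡⟨ cong (λ u → (suc (runLen w ∸ j) ∸ r) + alpha r u) drop-to-end ⟩
        (suc (runLen w ∸ j) ∸ r) + alpha r (drop (runLen w) w) ∎
      where
      open Eq.≡-Reasoning
      drop-to-end : drop (runLen w ∸ j) (drop j w) ≡ drop (runLen w) w
      drop-to-end = trans (ListP.drop-drop j (runLen w ∸ j) w) (cong (λ i → drop i w) (ℕP.m+[n∸m]≡n j≤run))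

  _+ᵥ_ : {n : ℕ} → Vec ℕ n → Vec ℕ n → Vec ℕ n
  _+ᵥ_ = zipWith _+_

  +ᵥ-identityˡ : {n : ℕ} (y : Vec ℕ n) → replicate n 0 +ᵥ y ≡ y
  +ᵥ-identityˡ [] = refl
  +ᵥ-identityˡ (y ∷ ys) = cong (y ∷_) (+ᵥ-identityˡ ys)

  +ᵥ-cancelˡ : {n : ℕ} (x y z : Vec ℕ n) → x +ᵥ y ≡ x +ᵥ z → y ≡ z
  +ᵥ-cancelˡ [] [] [] _ = refl
  +ᵥ-cancelˡ (x ∷ xs) (y ∷ ys) (z ∷ zs) eq =
    cong₂ _∷_ (ℕP.+-cancelˡ-≡ x y z (VecP.∷-injectiveˡ eq)) (+ᵥ-cancelˡ xs ys zs (VecP.∷-injectiveʳ eq))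

  sumℕ-+ᵥ : {n : ℕ} (x y : Vec ℕ n) → sumℕ (x +ᵥ y) ≡ sumℕ x + sumℕ y
  sumℕ-+ᵥ [] [] = refl
  sumℕ-+ᵥ (x ∷ xs) (y ∷ ys) rewrite sumℕ-+ᵥ xs ys = +-interchange x y (sumℕ xs) (sumℕ ys)
    where open import Algebra.Properties.CommutativeSemigroup ℕP.+-commutativeSemigroup
            using () renaming (interchange to +-interchange)

  sumℕ-replicate-0 : (n : ℕ) → sumℕ (replicate n 0) ≡ 0
  sumℕ-replicate-0 zero = refl
  sumℕ-replicate-0 (suc n) = sumℕ-replicate-0 n

  sumℕ≡0 : {n : ℕ} (x : Vec ℕ n) → sumℕ x ≡ 0 → x ≡ replicate n 0
  sumℕ≡0 [] _ = refl
  sumℕ≡0 (a ∷ x) eq = cong₂ _∷_ (ℕP.m+n≡0⇒m≡0 a eq) (sumℕ≡0 x (ℕP.m+n≡0⇒n≡0 a eq))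

  content-++ : {n : ℕ} (u w : List (Fin n)) → content (u ++ w) ≡ content u +ᵥ content w
  content-++ [] w = sym (+ᵥ-identityˡ (content w))
  content-++ (a ∷ u) w = trans (cong (λ z → updateAt z a suc) (content-++ u w)) (updateAt-+ᵥ a (content u) (content w))
    where
    updateAt-+ᵥ : {n : ℕ} (a : Fin n) (x y : Vec ℕ n) → updateAt (x +ᵥ y) a suc ≡ updateAt x a suc +ᵥ y
    updateAt-+ᵥ Fin.zero (x ∷ xs) (y ∷ ys) = refl
    updateAt-+ᵥ (Fin.suc a) (x ∷ xs) (y ∷ ys) = cong (x + y ∷_) (updateAt-+ᵥ a xs ys)

  sumℕ-content : {n : ℕ} (w : List (Fin n)) → sumℕ (content w) ≡ length w
  sumℕ-content {n} [] = sumℕ-replicate-0 n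
  sumℕ-content (a ∷ w) = trans (sumℕ-updateAt a (content w)) (cong suc (sumℕ-content w))
    where
    sumℕ-updateAt : {n : ℕ} (a : Fin n) (x : Vec ℕ n) → sumℕ (updateAt x a suc) ≡ suc (sumℕ x)
    sumℕ-updateAt Fin.zero (x ∷ xs) = refl
    sumℕ-updateAt (Fin.suc a) (x ∷ xs) = trans (cong (x +_) (sumℕ-updateAt a xs)) (ℕP.+-suc x _)

  bits : {n : ℕ} → Vec Bool n → Vec ℕ n
  bits = Vec.map (λ b → if b then 1 else 0)

  bits-injective : {n : ℕ} (v w : Vec Bool n) → bits v ≡ bits w → v ≡ w
  bits-injective [] [] _ = refl
  bits-injective (false ∷ v) (false ∷ w) eq = cong (false ∷_) (bits-injective v w (VecP.∷-injectiveʳ eq))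
  bits-injective (true ∷ v) (true ∷ w) eq = cong (true ∷_) (bits-injective v w (VecP.∷-injectiveʳ eq))
  bits-injective (false ∷ v) (true ∷ w) eq with VecP.∷-injectiveˡ eq
  ... | ()
  bits-injective (true ∷ v) (false ∷ w) eq with VecP.∷-injectiveˡ eq
  ... | ()

  sumℕ-bits : {n : ℕ} (v : Vec Bool n) → sumℕ (bits v) ≡ ones v
  sumℕ-bits [] = refl
  sumℕ-bits (b ∷ v) = cong ((if b then 1 else 0) +_) (sumℕ-bits v)

  ones≤length : {n : ℕ} (v : Vec Bool n) → ones v ≤ n
  ones≤length [] = z≤n
  ones≤length (false ∷ v) = ℕP.m≤n⇒m≤1+n (ones≤length v)
  ones≤length (true ∷ v) = s≤s (ones≤length v)

  _-ᵥ_ : {n : ℕ} → Vec ℕ n → Vec ℕ n → Vec ℤ n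
  _-ᵥ_ = zipWith (λ a b → ℤ.+ a ℤ.- ℤ.+ b)

  minus-bits : {n : ℕ} (m : Vec ℕ n) (v : Vec Bool n) → minus m v ≡ m -ᵥ bits v
  minus-bits [] [] = refl
  minus-bits (a ∷ m) (false ∷ v) = cong (_ ∷_) (minus-bits m v)
  minus-bits (a ∷ m) (true ∷ v) = cong (_ ∷_) (minus-bits m v)

  i-j≡k⇒i≡k+j : (i j k : ℤ) → i ℤ.- j ≡ k → i ≡ k ℤ.+ j
  i-j≡k⇒i≡k+j i j k eq = begin
    i                       ≡⟨ sym (ℤP.+-identityʳ i) ⟩
    i ℤ.+ ℤ.0ℤ              ≡⟨ cong (λ z → i ℤ.+ z) (sym (ℤP.+-inverseˡ j)) ⟩
    i ℤ.+ (ℤ.- j ℤ.+ j)     ≡⟨ sym (ℤP.+-assoc i (ℤ.- j) j) ⟩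
    i ℤ.- j ℤ.+ j           ≡⟨ cong (λ z → z ℤ.+ j) eq ⟩
    k ℤ.+ j ∎
    where open Eq.≡-Reasoning

  [j+k]-j≡k : (j k : ℤ) → j ℤ.+ k ℤ.- j ≡ k
  [j+k]-j≡k j k = begin
    j ℤ.+ k ℤ.- j           ≡⟨ cong (λ z → z ℤ.- j) (ℤP.+-comm j k) ⟩
    k ℤ.+ j ℤ.- j           ≡⟨ ℤP.+-assoc k j (ℤ.- j) ⟩
    k ℤ.+ (j ℤ.- j)         ≡⟨ cong (λ z → k ℤ.+ z) (ℤP.+-inverseʳ j) ⟩
    k ℤ.+ ℤ.0ℤ              ≡⟨ ℤP.+-identityʳ k ⟩
    k ∎
    where open Eq.≡-Reasoning

  natVec?-∷-just : {n c : ℕ} {u : Vec ℕ n} (z : ℤ) (v : Vec ℤ n) →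
    natVec? (z ∷ v) ≡ just (c ∷ u) → z ≡ ℤ.+ c × natVec? v ≡ just u
  natVec?-∷-just (ℤ.+ _) v eq with natVec? v
  natVec?-∷-just (ℤ.+ _) v refl | just _ = refl , refl
  natVec?-∷-just (ℤ.+ _) v () | nothing
  natVec?-∷-just ℤ.-[1+ _ ] v ()

  natVec?-minus-just : {n : ℕ} (m x m' : Vec ℕ n) → natVec? (m -ᵥ x) ≡ just m' → m ≡ x +ᵥ m'
  natVec?-minus-just [] [] [] _ = refl
  natVec?-minus-just (a ∷ m) (b ∷ x) (c ∷ m') eq with natVec?-∷-just (ℤ.+ a ℤ.- ℤ.+ b) (m -ᵥ x) eq
  ... | a-b≡c , rest = cong₂ _∷_ a≡b+c (natVec?-minus-just m x m' rest)
    where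
    a≡b+c : a ≡ b + c
    a≡b+c = ℤP.+-injective (trans (i-j≡k⇒i≡k+j (ℤ.+ a) (ℤ.+ b) (ℤ.+ c) a-b≡c) (ℤP.+-comm (ℤ.+ c) (ℤ.+ b)))

  natVec?-minus-sum : {n : ℕ} (x m' : Vec ℕ n) → natVec? ((x +ᵥ m') -ᵥ x) ≡ just m'
  natVec?-minus-sum [] [] = refl
  natVec?-minus-sum (b ∷ x) (c ∷ m') rewrite [j+k]-j≡k (ℤ.+ b) (ℤ.+ c) | natVec?-minus-sum x m' = refl

  -- A strictly increasing word is determined by its
  -- content, which is a 0-1 vector; conversely every 0-1 vector v is the
  -- content of the increasing word incWord v.  Hence increasing words of
  -- length k correspond bijectively to V_k.

  Increasing : {n : ℕ} → List (Fin n) → Set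
  Increasing u = incRun (length u) u ≡ true

  increasing-∷ : {n : ℕ} (a c : Fin n) (y : List (Fin n)) →
    Increasing (a ∷ c ∷ y) → a Fin.< c × Increasing (c ∷ y)
  increasing-∷ a c y inc with a Fin.<? c | inc
  ... | yes a<c | inc' = a<c , inc'
  ... | no _ | ()

  increasing-tail : {n : ℕ} (a : Fin n) (y : List (Fin n)) → Increasing (a ∷ y) → Increasing y
  increasing-tail a [] _ = refl
  increasing-tail a (c ∷ y) inc = proj₂ (increasing-∷ a c y inc)

  increasing-head≤ : {n : ℕ} (b : Fin n) (y : List (Fin n)) (i : Fin n) →
    Increasing (b ∷ y) → i ∈ b ∷ y → b Fin.≤ i
  increasing-head≤ b y i inc (here refl) = ℕP.≤-refl
  increasing-head≤ b (c ∷ y) i inc (there i∈) with increasing-∷ b c y inc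
  ... | b<c , inc' = ℕP.≤-trans (ℕP.<⇒≤ b<c) (increasing-head≤ c y i inc' i∈)

  ∈-content : {n : ℕ} (i : Fin n) (w : List (Fin n)) → ¬ lookup (content w) i ≡ 0 → i ∈ w
  ∈-content i [] count≢0 = ⊥-elim (count≢0 (VecP.lookup-replicate i 0))
  ∈-content i (x ∷ w) count≢0 with i Fin.≟ x
  ... | yes i≡x = here i≡x
  ... | no i≢x = there (∈-content i w (λ eq → count≢0 (trans (VecP.lookup∘updateAt′ i x i≢x (content w)) eq)))

  content-head≢0 : {n : ℕ} (a : Fin n) (w : List (Fin n)) → ¬ lookup (content (a ∷ w)) a ≡ 0
  content-head≢0 a w eq with trans (sym (VecP.lookup∘updateAt a (content w))) eq
  ... | ()

  -- An increasing word is determined by its content: the two heads are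
  -- both the least letter occurring, and the tails have equal content.
  increasing-unique : {n : ℕ} (u u' : List (Fin n)) → Increasing u → Increasing u' →
    content u ≡ content u' → u ≡ u'
  increasing-unique [] [] _ _ _ = refl
  increasing-unique [] (b ∷ y) _ _ eq =
    ⊥-elim (content-head≢0 b y (trans (cong (λ z → lookup z b) (sym eq)) (VecP.lookup-replicate b 0)))
  increasing-unique (a ∷ x) [] _ _ eq =
    ⊥-elim (content-head≢0 a x (trans (cong (λ z → lookup z a) eq) (VecP.lookup-replicate a 0)))
  increasing-unique (a ∷ x) (b ∷ y) inc inc' eq =
    cong₂ _∷_ a≡b (increasing-unique x y (increasing-tail a x inc) (increasing-tail b y inc') tails)
    where
    a≤b : a Fin.≤ b
    a≤b = increasing-head≤ a x b inc
      (∈-content b (a ∷ x) (λ e → content-head≢0 b y (trans (cong (λ z → lookup z b) (sym eq)) e)))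
    b≤a : b Fin.≤ a
    b≤a = increasing-head≤ b y a inc'
      (∈-content a (b ∷ y) (λ e → content-head≢0 a x (trans (cong (λ z → lookup z a) eq) e)))
    a≡b : a ≡ b
    a≡b = FinP.≤-antisym a≤b b≤a
    tails : content x ≡ content y
    tails = updateAt-suc-injective a (content x) (content y)
      (trans eq (cong (λ z → updateAt (content y) z suc) (sym a≡b)))
      where
      updateAt-suc-injective : {n : ℕ} (a : Fin n) (x y : Vec ℕ n) → updateAt x a suc ≡ updateAt y a suc → x ≡ y
      updateAt-suc-injective Fin.zero (x ∷ xs) (y ∷ ys) e =
        cong₂ _∷_ (ℕP.suc-injective (VecP.∷-injectiveˡ e)) (VecP.∷-injectiveʳ e)
      updateAt-suc-injective (Fin.suc a) (x ∷ xs) (y ∷ ys) e =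
        cong₂ _∷_ (VecP.∷-injectiveˡ e) (updateAt-suc-injective a xs ys (VecP.∷-injectiveʳ e))

  increasing-head∉ : {n : ℕ} (a : Fin n) (x : List (Fin n)) → Increasing (a ∷ x) → lookup (content x) a ≡ 0
  increasing-head∉ a [] _ = VecP.lookup-replicate a 0
  increasing-head∉ a (c ∷ y) inc with lookup (content (c ∷ y)) a ℕ.≟ 0
  ... | yes count≡0 = count≡0
  ... | no count≢0 with increasing-∷ a c y inc
  ...   | a<c , inc' = ⊥-elim (ℕP.<-irrefl refl
            (ℕP.<-≤-trans a<c (increasing-head≤ c y a inc' (∈-content a (c ∷ y) count≢0))))

  increasing-bits : {n : ℕ} (u : List (Fin n)) → Increasing u → Σ (Vec Bool n) (λ v → content u ≡ bits v)
  increasing-bits {n} [] _ = replicate n false , replicate-bits n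
    where
    replicate-bits : (n : ℕ) → replicate n 0 ≡ bits (replicate n false)
    replicate-bits zero = refl
    replicate-bits (suc n) = cong (0 ∷_) (replicate-bits n)
  increasing-bits (a ∷ x) inc with increasing-bits x (increasing-tail a x inc)
  ... | v , content≡ = updateAt v a (λ _ → true) ,
    trans (cong (λ z → updateAt z a suc) content≡) (set-bit a v (trans (cong (λ z → lookup z a) (sym content≡)) (increasing-head∉ a x inc)))
    where
    set-bit : {n : ℕ} (a : Fin n) (v : Vec Bool n) → lookup (bits v) a ≡ 0 →
      updateAt (bits v) a suc ≡ bits (updateAt v a (λ _ → true))
    set-bit Fin.zero (false ∷ v) _ = refl
    set-bit Fin.zero (true ∷ v) ()
    set-bit (Fin.suc a) (b ∷ v) eq = cong (_ ∷_) (set-bit a v eq)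

  content-map-suc : {n : ℕ} (w : List (Fin n)) → content (map Fin.suc w) ≡ 0 ∷ content w
  content-map-suc [] = refl
  content-map-suc (a ∷ w) = cong (λ z → updateAt z (Fin.suc a) suc) (content-map-suc w)

  incRun-map-suc : {n : ℕ} (k : ℕ) (w : List (Fin n)) → incRun k (map Fin.suc w) ≡ incRun k w
  incRun-map-suc zero w = refl
  incRun-map-suc (suc zero) [] = refl
  incRun-map-suc (suc zero) (x ∷ w) = refl
  incRun-map-suc (suc (suc k)) [] = refl
  incRun-map-suc (suc (suc k)) (x ∷ []) = refl
  incRun-map-suc (suc (suc k)) (x ∷ y ∷ w) = cong₂ _∧_ suc<?suc (incRun-map-suc (suc k) (y ∷ w))
    where
    suc<?suc : ⌊ Fin.suc x Fin.<? Fin.suc y ⌋ ≡ ⌊ x Fin.<? y ⌋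
    suc<?suc with Fin.suc x Fin.<? Fin.suc y | x Fin.<? y
    ... | yes _ | yes _ = refl
    ... | no _ | no _ = refl
    ... | yes sx<sy | no x≮y = ⊥-elim (x≮y (ℕP.≤-pred sx<sy))
    ... | no sx≮sy | yes x<y = ⊥-elim (sx≮sy (s≤s x<y))

  increasing-map-suc : {n : ℕ} (w : List (Fin n)) → Increasing w → Increasing (map Fin.suc w)
  increasing-map-suc w inc =
    trans (cong (λ k → incRun k (map Fin.suc w)) (ListP.length-map Fin.suc w)) (trans (incRun-map-suc (length w) w) inc)

  incWord : {n : ℕ} → Vec Bool n → List (Fin n)
  incWord [] = []
  incWord (false ∷ v) = map Fin.suc (incWord v)
  incWord (true ∷ v) = Fin.zero ∷ map Fin.suc (incWord v)

  content-incWord : {n : ℕ} (v : Vec Bool n) → content (incWord v) ≡ bits v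
  content-incWord [] = refl
  content-incWord (false ∷ v) = trans (content-map-suc (incWord v)) (cong (0 ∷_) (content-incWord v))
  content-incWord (true ∷ v) =
    trans (cong (λ z → updateAt z Fin.zero suc) (content-map-suc (incWord v))) (cong (1 ∷_) (content-incWord v))

  length-incWord : {n : ℕ} (v : Vec Bool n) → length (incWord v) ≡ ones v
  length-incWord [] = refl
  length-incWord (false ∷ v) = trans (ListP.length-map Fin.suc (incWord v)) (length-incWord v)
  length-incWord (true ∷ v) = cong suc (trans (ListP.length-map Fin.suc (incWord v)) (length-incWord v))

  incWord-increasing : {n : ℕ} (v : Vec Bool n) → Increasing (incWord v)
  incWord-increasing [] = refl
  incWord-increasing (false ∷ v) = increasing-map-suc (incWord v) (incWord-increasing v)
  incWord-increasing (true ∷ v) with incWord v | increasing-map-suc (incWord v) (incWord-increasing v)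
  ... | [] | _ = refl
  ... | y ∷ w | inc = inc

open WordCombinatorics

module Sums {c ℓ : Level} (R : CommutativeRing c ℓ) where
  open CommutativeRing R
  open Poly R using (sumR)
  open import Relation.Binary.Reasoning.Setoid setoid
  open import Algebra.Properties.CommutativeSemigroup +-commutativeSemigroup using (interchange)

  𝟙 : {p : Level} {P : Set p} → Dec P → Carrier
  𝟙 (yes _) = 1#
  𝟙 (no _) = 0#

  𝟙-yes : {p : Level} {P : Set p} (d : Dec P) → P → 𝟙 d ≈ 1#
  𝟙-yes (yes _) _ = refl
  𝟙-yes (no ¬p) p = ⊥-elim (¬p p)

  𝟙-no : {p : Level} {P : Set p} (d : Dec P) → ¬ P → 𝟙 d ≈ 0#
  𝟙-no (yes p) ¬p = ⊥-elim (¬p p)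
  𝟙-no (no _) _ = refl

  𝟙-⇔ : {p q : Level} {P : Set p} {Q : Set q} (d : Dec P) (e : Dec Q) → (P → Q) → (Q → P) → 𝟙 d ≈ 𝟙 e
  𝟙-⇔ (yes p) e to from = sym (𝟙-yes e (to p))
  𝟙-⇔ (no ¬p) e to from = sym (𝟙-no e (λ q → ¬p (from q)))

  𝟙-× : {p q s : Level} {P : Set p} {Q : Set q} {S : Set s} (d : Dec P) (e : Dec Q) (f : Dec S) (x : Carrier) →
    (P → Q) → (P → S) → (Q → S → P) → 𝟙 d * x ≈ 𝟙 e * (𝟙 f * x)
  𝟙-× d (yes q) (yes s) x _ _ both = trans (*-congʳ (𝟙-yes d (both q s))) (sym (*-identityˡ _))
  𝟙-× d (yes q) (no ¬s) x _ toS _ =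
    trans (*-congʳ (𝟙-no d (λ p → ¬s (toS p)))) (trans (zeroˡ x) (sym (trans (*-identityˡ _) (zeroˡ x))))
  𝟙-× d (no ¬q) f x toQ _ _ = trans (*-congʳ (𝟙-no d (λ p → ¬q (toQ p)))) (trans (zeroˡ x) (sym (zeroˡ _)))

  bit : Bool → Carrier
  bit b = if b then 1# else 0#

  private variable
    a b : Level
    A : Set a
    B : Set b

  ∑ : List A → (A → Carrier) → Carrier
  ∑ xs f = sumR (map f xs)

  ∑-cong : {f g : A → Carrier} (xs : List A) → (∀ x → f x ≈ g x) → ∑ xs f ≈ ∑ xs g
  ∑-cong [] _ = refl
  ∑-cong (x ∷ xs) f≈g = +-cong (f≈g x) (∑-cong xs f≈g)

  ∑-zero : {f : A → Carrier} (xs : List A) → (∀ x → f x ≈ 0#) → ∑ xs f ≈ 0#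
  ∑-zero [] _ = refl
  ∑-zero (x ∷ xs) f≈0 = trans (+-cong (f≈0 x) (∑-zero xs f≈0)) (+-identityˡ 0#)

  ∑-+ : (xs : List A) (f g : A → Carrier) → ∑ xs (λ x → f x + g x) ≈ ∑ xs f + ∑ xs g
  ∑-+ [] f g = sym (+-identityˡ 0#)
  ∑-+ (x ∷ xs) f g = trans (+-congˡ (∑-+ xs f g)) (interchange (f x) (g x) _ _)

  ∑-*ˡ : (k : Carrier) (xs : List A) (f : A → Carrier) → ∑ xs (λ x → k * f x) ≈ k * ∑ xs f
  ∑-*ˡ k [] f = sym (zeroʳ k)
  ∑-*ˡ k (x ∷ xs) f = trans (+-congˡ (∑-*ˡ k xs f)) (sym (distribˡ k (f x) _))

  ∑-++ : (xs ys : List A) (f : A → Carrier) → ∑ (xs ++ ys) f ≈ ∑ xs f + ∑ ys f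
  ∑-++ [] ys f = sym (+-identityˡ _)
  ∑-++ (x ∷ xs) ys f = trans (+-congˡ (∑-++ xs ys f)) (sym (+-assoc _ _ _))

  ∑-filter : {p : Level} {P : A → Set p} (P? : ∀ x → Dec (P x)) (xs : List A) (f : A → Carrier) →
    ∑ (List.filter P? xs) f ≈ ∑ xs (λ x → 𝟙 (P? x) * f x)
  ∑-filter P? [] f = refl
  ∑-filter P? (x ∷ xs) f with P? x
  ... | yes _ = +-cong (sym (*-identityˡ (f x))) (∑-filter P? xs f)
  ... | no _ = trans (∑-filter P? xs f) (sym (trans (+-congʳ (zeroˡ (f x))) (+-identityˡ _)))

  ∑-map : (g : A → B) (xs : List A) (f : B → Carrier) → ∑ (map g xs) f ≈ ∑ xs (λ x → f (g x))
  ∑-map g [] f = refl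
  ∑-map g (x ∷ xs) f = +-congˡ (∑-map g xs f)

  ∑-concatMap : (G : A → List B) (xs : List A) (f : B → Carrier) →
    ∑ (List.concatMap G xs) f ≈ ∑ xs (λ x → ∑ (G x) f)
  ∑-concatMap G [] f = refl
  ∑-concatMap G (x ∷ xs) f = trans (∑-++ (G x) (List.concatMap G xs) f) (+-congˡ (∑-concatMap G xs f))

  ∑-swap : (xs : List A) (ys : List B) (F : A → B → Carrier) →
    ∑ xs (λ x → ∑ ys (F x)) ≈ ∑ ys (λ y → ∑ xs (λ x → F x y))
  ∑-swap [] ys F = sym (∑-zero ys (λ _ → refl))
  ∑-swap (x ∷ xs) ys F = trans (+-congˡ (∑-swap xs ys F)) (sym (∑-+ ys (F x) (λ y → ∑ xs (λ x → F x y))))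

  ∑< : ℕ → (ℕ → Carrier) → Carrier
  ∑< zero f = 0#
  ∑< (suc n) f = f 0 + ∑< n (λ k → f (suc k))

  ∑<-cong : {f g : ℕ → Carrier} (n : ℕ) → (∀ k → k < n → f k ≈ g k) → ∑< n f ≈ ∑< n g
  ∑<-cong zero _ = refl
  ∑<-cong (suc n) f≈g = +-cong (f≈g 0 (s≤s z≤n)) (∑<-cong n (λ k k<n → f≈g (suc k) (s≤s k<n)))

  ∑<-zero : {f : ℕ → Carrier} (n : ℕ) → (∀ k → k < n → f k ≈ 0#) → ∑< n f ≈ 0#
  ∑<-zero zero _ = refl
  ∑<-zero (suc n) f≈0 = trans (+-cong (f≈0 0 (s≤s z≤n)) (∑<-zero n (λ k k<n → f≈0 (suc k) (s≤s k<n)))) (+-identityˡ 0#)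

  ∑<-+ : (n : ℕ) (f g : ℕ → Carrier) → ∑< n (λ k → f k + g k) ≈ ∑< n f + ∑< n g
  ∑<-+ zero f g = sym (+-identityˡ 0#)
  ∑<-+ (suc n) f g = trans (+-congˡ (∑<-+ n (λ k → f (suc k)) (λ k → g (suc k)))) (interchange (f 0) (g 0) _ _)

  ∑<-*ˡ : (x : Carrier) (n : ℕ) (f : ℕ → Carrier) → ∑< n (λ k → x * f k) ≈ x * ∑< n f
  ∑<-*ˡ x zero f = sym (zeroʳ x)
  ∑<-*ˡ x (suc n) f = trans (+-congˡ (∑<-*ˡ x n (λ k → f (suc k)))) (sym (distribˡ x (f 0) _))

  ∑<-suc : (n : ℕ) (f : ℕ → Carrier) → ∑< (suc n) f ≈ ∑< n f + f n
  ∑<-suc zero f = trans (+-identityʳ (f 0)) (sym (+-identityˡ (f 0)))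
  ∑<-suc (suc n) f = trans (+-congˡ (∑<-suc n (λ k → f (suc k)))) (sym (+-assoc _ _ _))

  ∑<-split : (a b : ℕ) (f : ℕ → Carrier) → ∑< (a ℕ.+ b) f ≈ ∑< a f + ∑< b (λ i → f (a ℕ.+ i))
  ∑<-split zero b f = sym (+-identityˡ _)
  ∑<-split (suc a) b f = trans (+-congˡ (∑<-split a b (λ k → f (suc k)))) (sym (+-assoc _ _ _))

  ∑<-extend : (a b : ℕ) (f : ℕ → Carrier) → a ≤ b → (∀ k → a ≤ k → f k ≈ 0#) → ∑< a f ≈ ∑< b f
  ∑<-extend a b f a≤b f≈0 = begin
    ∑< a f                                   ≈⟨ sym (+-identityʳ _) ⟩
    ∑< a f + 0#                              ≈⟨ +-congˡ (sym (∑<-zero (b ∸ a) (λ k _ → f≈0 (a ℕ.+ k) (ℕP.m≤m+n a k)))) ⟩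
    ∑< a f + ∑< (b ∸ a) (λ i → f (a ℕ.+ i))  ≈⟨ sym (∑<-split a (b ∸ a) f) ⟩
    ∑< (a ℕ.+ (b ∸ a)) f                     ≡⟨ Eq.cong (λ k → ∑< k f) (ℕP.m+[n∸m]≡n a≤b) ⟩
    ∑< b f ∎

  ∑<-swap : (m n : ℕ) (F : ℕ → ℕ → Carrier) → ∑< m (λ i → ∑< n (F i)) ≈ ∑< n (λ k → ∑< m (λ i → F i k))
  ∑<-swap zero n F = sym (∑<-zero n (λ _ _ → refl))
  ∑<-swap (suc m) n F =
    trans (+-congˡ (∑<-swap m n (λ i → F (suc i)))) (sym (∑<-+ n (F 0) (λ k → ∑< m (λ i → F (suc i) k))))

  ∑<-∑-swap : (n : ℕ) (xs : List A) (F : ℕ → A → Carrier) → ∑< n (λ k → ∑ xs (F k)) ≈ ∑ xs (λ x → ∑< n (λ k → F k x))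
  ∑<-∑-swap zero xs F = sym (∑-zero xs (λ _ → refl))
  ∑<-∑-swap (suc n) xs F =
    trans (+-congˡ (∑<-∑-swap n xs (λ k → F (suc k)))) (sym (∑-+ xs (F 0) (λ x → ∑< n (λ k → F (suc k) x))))

  ∑-upTo : (n : ℕ) (f : ℕ → Carrier) → ∑ (List.upTo n) f ≈ ∑< n f
  ∑-upTo n f = ∑-applyUpTo n (λ k → k)
    where
    ∑-applyUpTo : (n : ℕ) (g : ℕ → ℕ) → ∑ (List.applyUpTo g n) f ≈ ∑< n (λ k → f (g k))
    ∑-applyUpTo zero g = refl
    ∑-applyUpTo (suc n) g = +-congˡ (∑-applyUpTo n (λ k → g (suc k)))

  _⋆_ : (ℕ → Carrier) → (ℕ → Carrier) → ℕ → Carrier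
  (a ⋆ s) L = ∑< (suc L) (λ k → a k * s (L ∸ k))

  ⋆-congˡ : {a b : ℕ → Carrier} (s : ℕ → Carrier) (L : ℕ) → (∀ k → a k ≈ b k) → (a ⋆ s) L ≈ (b ⋆ s) L
  ⋆-congˡ {a} s L a≈b = ∑<-cong {λ k → a k * s (L ∸ k)} (suc L) (λ k _ → *-congʳ (a≈b k))

  ⋆-+ : (a b s : ℕ → Carrier) (L : ℕ) → ((λ k → a k + b k) ⋆ s) L ≈ (a ⋆ s) L + (b ⋆ s) L
  ⋆-+ a b s L = trans (∑<-cong (suc L) (λ k _ → distribʳ (s (L ∸ k)) (a k) (b k)))
                      (∑<-+ (suc L) (λ k → a k * s (L ∸ k)) (λ k → b k * s (L ∸ k)))

  ⋆-*ˡ : (x : Carrier) (a s : ℕ → Carrier) (L : ℕ) → ((λ k → x * a k) ⋆ s) L ≈ x * (a ⋆ s) L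
  ⋆-*ˡ x a s L = trans (∑<-cong (suc L) (λ k _ → *-assoc x (a k) (s (L ∸ k))))
                       (∑<-*ˡ x (suc L) (λ k → a k * s (L ∸ k)))

  ⋆-∑< : (J : ℕ) (F : ℕ → ℕ → Carrier) (s : ℕ → Carrier) (L : ℕ) →
    ((λ k → ∑< J (λ i → F i k)) ⋆ s) L ≈ ∑< J (λ i → (F i ⋆ s) L)
  ⋆-∑< J F s L = begin
    ∑< (suc L) (λ k → ∑< J (λ i → F i k) * s (L ∸ k))   ≈⟨ ∑<-cong (suc L) (λ k _ → *-comm (∑< J (λ i → F i k)) (s (L ∸ k))) ⟩
    ∑< (suc L) (λ k → s (L ∸ k) * ∑< J (λ i → F i k))   ≈⟨ ∑<-cong (suc L) (λ k _ → sym (∑<-*ˡ (s (L ∸ k)) J (λ i → F i k))) ⟩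
    ∑< (suc L) (λ k → ∑< J (λ i → s (L ∸ k) * F i k))   ≈⟨ ∑<-swap (suc L) J (λ k i → s (L ∸ k) * F i k) ⟩
    ∑< J (λ i → ∑< (suc L) (λ k → s (L ∸ k) * F i k))   ≈⟨ ∑<-cong J (λ i _ → ∑<-cong (suc L) (λ k _ → *-comm (s (L ∸ k)) (F i k))) ⟩
    ∑< J (λ i → (F i ⋆ s) L) ∎

  ⋆-delay : (a s : ℕ → Carrier) → a 0 ≈ 0# → (j L : ℕ) → ((λ k → a (k ∸ j)) ⋆ s) L ≈ (a ⋆ s) (L ∸ j)
  ⋆-delay a s a0≈0 zero L = refl
  ⋆-delay a s a0≈0 (suc j) zero = refl
  ⋆-delay a s a0≈0 (suc j) (suc L) =
    trans (+-cong (trans (*-congʳ a0≈0) (zeroˡ _)) (⋆-delay a s a0≈0 j L)) (+-identityˡ _)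

  impulse : ℕ → ℕ → Carrier
  impulse zero zero = 1#
  impulse zero (suc k) = 0#
  impulse (suc j) zero = 0#
  impulse (suc j) (suc k) = impulse j k

  impulse-⋆ : (j : ℕ) (s : ℕ → Carrier) (L : ℕ) → j ≤ L → (impulse j ⋆ s) L ≈ s (L ∸ j)
  impulse-⋆ zero s L _ =
    trans (+-cong (*-identityˡ _) (∑<-zero L (λ k _ → zeroˡ _))) (+-identityʳ _)
  impulse-⋆ (suc j) s (suc L) (s≤s j≤L) = trans (+-cong (zeroˡ _) (impulse-⋆ j s L j≤L)) (+-identityˡ _)

  impulse-⋆-early : (j : ℕ) (s : ℕ → Carrier) (L : ℕ) → L < j → (impulse j ⋆ s) L ≈ 0#
  impulse-⋆-early (suc j) s zero _ = trans (+-identityʳ _) (zeroˡ _)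
  impulse-⋆-early (suc j) s (suc L) (s≤s L<j) = trans (+-cong (zeroˡ _) (impulse-⋆-early j s L L<j)) (+-identityˡ _)

-- The weight of an increasing run of length L is t^{(L+1) ∸ r}, since the
-- run contains (L+1) ∸ r occurrences of 12⋯r.  The recursion defining P
-- is exactly what makes the weights satisfy
--   weight L = ∑_{k=1}^{L} coeff k · weight (L - k)     (L ≥ 1)
-- with coeff 1 = 1 and coeff k = p k for k ≥ 2; this identity is the
-- heart of the theorem.
module Coefficients {c ℓ : Level} (R : CommutativeRing c ℓ) (ρ : ℕ) (t : CommutativeRing.Carrier R) where
  open CommutativeRing R
  open Poly R
  open Sums R
  open import Relation.Binary.Reasoning.Setoid setoid
  open import Algebra.Properties.Ring ring using ([y-z]x≈yx-zx)

  [a-b]+[b-c]≈a-c : (a b c : Carrier) → (a - b) + (b - c) ≈ a - c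
  [a-b]+[b-c]≈a-c a b c = begin
    (a - b) + (b - c)   ≈⟨ +-assoc a (- b) _ ⟩
    a + (- b + (b - c)) ≈⟨ +-congˡ (sym (+-assoc (- b) b (- c))) ⟩
    a + ((- b + b) - c) ≈⟨ +-congˡ (+-congʳ (-‿inverseˡ b)) ⟩
    a + (0# - c)        ≈⟨ +-congˡ (+-identityˡ (- c)) ⟩
    a - c ∎

  x+[y-x]≈y : (x y : Carrier) → x + (y - x) ≈ y
  x+[y-x]≈y x y = begin
    x + (y - x)   ≈⟨ +-congˡ (+-comm y (- x)) ⟩
    x + (- x + y) ≈⟨ sym (+-assoc x (- x) y) ⟩
    (x - x) + y   ≈⟨ +-congʳ (-‿inverseʳ x) ⟩
    0# + y        ≈⟨ +-identityˡ y ⟩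
    y ∎

  r : ℕ
  r = suc (suc ρ)

  p : ℕ → Carrier
  p k = P r k t

  p-below : (k : ℕ) → k < r → p k ≈ 0#
  p-below zero _ = refl
  p-below (suc k) k<r with suc k ℕ.<? r
  ... | yes _ = refl
  ... | no k≮r = ⊥-elim (k≮r k<r)

  impulse-on : (k : ℕ) → impulse k k ≈ 1#
  impulse-on zero = refl
  impulse-on (suc k) = impulse-on k

  impulse-off : (j k : ℕ) → ¬ j ≡ k → impulse j k ≈ 0#
  impulse-off zero zero j≢k = ⊥-elim (j≢k Eq.refl)
  impulse-off zero (suc k) _ = refl
  impulse-off (suc j) zero _ = refl
  impulse-off (suc j) (suc k) j≢k = impulse-off j k (λ j≡k → j≢k (Eq.cong suc j≡k))

  history-take : (j k : ℕ) → sumR (List.take j (Phist r t k)) ≈ ∑< j (λ i → p (k ∸ i))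
  history-take zero k = refl
  history-take (suc j) zero = sym (∑<-zero (suc j) (λ i _ → p-below (0 ∸ i) (ℕP.≤-<-trans (ℕP.≤-reflexive (ℕP.0∸n≡0 i)) (s≤s z≤n))))
  history-take (suc j) (suc k) = +-congˡ (history-take j k)

  -- The three defining cases of P fused into one recurrence valid for all k:
  --   p k = (t - 1) (impulse r k + p (k-1) + ⋯ + p (k-r+1)).
  p-recurrence : (k : ℕ) → p k ≈ (t - 1#) * (impulse r k + ∑< (suc ρ) (λ i → p (k ∸ suc i)))
  p-recurrence zero = sym (vanishing refl (λ _ _ → refl))
    where
    vanishing : {e : Carrier} {f : ℕ → Carrier} → e ≈ 0# → (∀ i → i < suc ρ → f i ≈ 0#) →
      (t - 1#) * (e + ∑< (suc ρ) f) ≈ 0#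
    vanishing e≈0 f≈0 = trans (*-congˡ (trans (+-cong e≈0 (∑<-zero (suc ρ) f≈0)) (+-identityˡ 0#))) (zeroʳ _)
  p-recurrence (suc k) with suc k ℕ.<? r
  ... | yes k<r = sym (trans
          (*-congˡ (+-cong (impulse-off r (suc k) (λ eq → ℕP.<⇒≢ k<r (Eq.sym eq)))
                           (∑<-zero (suc ρ) (λ i _ → p-below (k ∸ i) (ℕP.≤-<-trans (ℕP.m∸n≤m k i) (ℕP.<-trans (ℕP.n<1+n k) k<r))))))
          (trans (*-congˡ (+-identityˡ 0#)) (zeroʳ _)))
  ... | no k≮r with suc k ℕ.≟ r
  ...   | yes k≡r = sym (trans
          (*-congˡ (+-cong (Eq.subst (λ z → impulse z (suc k) ≈ 1#) k≡r (impulse-on (suc k)))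
                           (∑<-zero (suc ρ) (λ i _ → p-below (k ∸ i) (Eq.subst (k ∸ i <_) k≡r (s≤s (ℕP.m∸n≤m k i)))))))
          (trans (*-congˡ (+-identityʳ 1#)) (*-identityʳ _)))
  ...   | no k≢r = *-congˡ (begin
          sumR (List.take (suc ρ) (Phist r t k))         ≈⟨ history-take (suc ρ) k ⟩
          ∑< (suc ρ) (λ i → p (k ∸ i))                     ≈⟨ sym (+-identityˡ _) ⟩
          0# + ∑< (suc ρ) (λ i → p (k ∸ i))                ≈⟨ +-congʳ (sym (impulse-off r (suc k) (λ eq → k≢r (Eq.sym eq)))) ⟩
          impulse r (suc k) + ∑< (suc ρ) (λ i → p (k ∸ i)) ∎)

  pow-+ : (a b : ℕ) → pow t (a ℕ.+ b) ≈ pow t a * pow t b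
  pow-+ zero b = sym (*-identityˡ _)
  pow-+ (suc a) b = trans (*-congˡ (pow-+ a b)) (sym (*-assoc _ _ _))

  weight : ℕ → Carrier
  weight L = pow t (suc L ∸ r)

  Δweight : ℕ → Carrier
  Δweight L = weight L - weight (L ∸ 1)

  Δweight-telescope : (L J : ℕ) → ∑< J (λ i → Δweight (L ∸ suc i)) ≈ weight (L ∸ 1) - weight (L ∸ suc J)
  Δweight-telescope L zero = sym (-‿inverseʳ _)
  Δweight-telescope L (suc J) = begin
    ∑< (suc J) (λ i → Δweight (L ∸ suc i))                           ≈⟨ ∑<-suc J (λ i → Δweight (L ∸ suc i)) ⟩
    ∑< J (λ i → Δweight (L ∸ suc i)) + Δweight (L ∸ suc J)           ≈⟨ +-congʳ (Δweight-telescope L J) ⟩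
    (weight (L ∸ 1) - weight (L ∸ suc J)) + Δweight (L ∸ suc J)      ≈⟨ [a-b]+[b-c]≈a-c _ _ _ ⟩
    weight (L ∸ 1) - weight (L ∸ suc J ∸ 1)                          ≡⟨ Eq.cong (λ z → weight (L ∸ 1) - weight z) L∸[1+J]∸1 ⟩
    weight (L ∸ 1) - weight (L ∸ suc (suc J)) ∎
    where
    L∸[1+J]∸1 : L ∸ suc J ∸ 1 ≡ L ∸ suc (suc J)
    L∸[1+J]∸1 = Eq.trans (ℕP.∸-+-assoc L (suc J) 1) (Eq.cong (L ∸_) (ℕP.+-comm (suc J) 1))

  p⋆weight-step : (L : ℕ) →
    (p ⋆ weight) L ≈ (t - 1#) * ((impulse r ⋆ weight) L + ∑< (suc ρ) (λ i → (p ⋆ weight) (L ∸ suc i)))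
  p⋆weight-step L = begin
    (p ⋆ weight) L
      ≈⟨ ⋆-congˡ weight L p-recurrence ⟩
    ((λ k → (t - 1#) * (impulse r k + ∑< (suc ρ) (λ i → p (k ∸ suc i)))) ⋆ weight) L
      ≈⟨ ⋆-*ˡ (t - 1#) (λ k → impulse r k + ∑< (suc ρ) (λ i → p (k ∸ suc i))) weight L ⟩
    (t - 1#) * (((λ k → impulse r k + ∑< (suc ρ) (λ i → p (k ∸ suc i))) ⋆ weight) L)
      ≈⟨ *-congˡ (⋆-+ (impulse r) (λ k → ∑< (suc ρ) (λ i → p (k ∸ suc i))) weight L) ⟩
    (t - 1#) * ((impulse r ⋆ weight) L + ((λ k → ∑< (suc ρ) (λ i → p (k ∸ suc i))) ⋆ weight) L)
      ≈⟨ *-congˡ (+-congˡ (⋆-∑< (suc ρ) (λ i k → p (k ∸ suc i)) weight L)) ⟩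
    (t - 1#) * ((impulse r ⋆ weight) L + ∑< (suc ρ) (λ i → ((λ k → p (k ∸ suc i)) ⋆ weight) L))
      ≈⟨ *-congˡ (+-congˡ (∑<-cong (suc ρ) (λ i _ → ⋆-delay p weight refl (suc i) L))) ⟩
    (t - 1#) * ((impulse r ⋆ weight) L + ∑< (suc ρ) (λ i → (p ⋆ weight) (L ∸ suc i))) ∎

  p⋆weight : (L : ℕ) → (p ⋆ weight) L ≈ Δweight L
  p⋆weight = <-rec (λ L → (p ⋆ weight) L ≈ Δweight L) step
    where
    step : (L : ℕ) → (∀ {L'} → L' < L → (p ⋆ weight) L' ≈ Δweight L') → (p ⋆ weight) L ≈ Δweight L
    step zero _ = trans (+-identityʳ _) (trans (zeroˡ _) (sym (-‿inverseʳ _)))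
    step (suc L') ih = begin
      (p ⋆ weight) L
        ≈⟨ p⋆weight-step L ⟩
      (t - 1#) * ((impulse r ⋆ weight) L + ∑< (suc ρ) (λ i → (p ⋆ weight) (L ∸ suc i)))
        ≈⟨ *-congˡ (+-congˡ (∑<-cong (suc ρ) (λ i _ → ih (s≤s (ℕP.m∸n≤m L' i))))) ⟩
      (t - 1#) * ((impulse r ⋆ weight) L + ∑< (suc ρ) (λ i → Δweight (L ∸ suc i)))
        ≈⟨ *-congˡ (+-congˡ (Δweight-telescope L (suc ρ))) ⟩
      (t - 1#) * ((impulse r ⋆ weight) L + (weight L' - weight (L ∸ r)))
        ≈⟨ close (r ℕ.≤? L) ⟩
      Δweight L ∎
      where
      L = suc L'
      close : Dec (r ≤ L) → (t - 1#) * ((impulse r ⋆ weight) L + (weight L' - weight (L ∸ r))) ≈ Δweight L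
      close (yes r≤L) = begin
        (t - 1#) * ((impulse r ⋆ weight) L + (weight L' - weight (L ∸ r)))
          ≈⟨ *-congˡ (+-congʳ (impulse-⋆ r weight L r≤L)) ⟩
        (t - 1#) * (weight (L ∸ r) + (weight L' - weight (L ∸ r)))
          ≈⟨ *-congˡ (x+[y-x]≈y _ _) ⟩
        (t - 1#) * weight L'
          ≈⟨ trans ([y-z]x≈yx-zx (weight L') t 1#) (+-congˡ (-‿cong (*-identityˡ _))) ⟩
        t * weight L' - weight L'
          ≡⟨ Eq.cong (λ e → pow t e - weight L') (Eq.sym (ℕP.+-∸-assoc 1 r≤L)) ⟩
        Δweight L ∎
      close (no r≰L) = begin
        (t - 1#) * ((impulse r ⋆ weight) L + (weight L' - weight (L ∸ r)))
          ≈⟨ *-congˡ (+-cong (impulse-⋆-early r weight L L<r) (trans (-‿congʳ' (weight-early L' L'<r) (weight-early (L ∸ r) L∸r<r)) (-‿inverseʳ 1#))) ⟩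
        (t - 1#) * (0# + 0#)
          ≈⟨ trans (*-congˡ (+-identityˡ 0#)) (zeroʳ _) ⟩
        0#
          ≈⟨ sym (trans (-‿congʳ' (weight-early L L<r) (weight-early L' L'<r)) (-‿inverseʳ 1#)) ⟩
        Δweight L ∎
        where
        L<r : L < r
        L<r = ℕP.≰⇒> r≰L
        L'<r : L' < r
        L'<r = ℕP.<-trans (ℕP.n<1+n L') L<r
        L∸r<r : L ∸ r < r
        L∸r<r = ℕP.≤-<-trans (ℕP.m∸n≤m L r) L<r
        weight-early : (K : ℕ) → K < r → weight K ≈ 1#
        weight-early K K<r = reflexive (Eq.cong (pow t) (ℕP.m≤n⇒m∸n≡0 K<r))
        -‿congʳ' : {a b : Carrier} → a ≈ 1# → b ≈ 1# → a - b ≈ 1# - 1#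
        -‿congʳ' a≈1 b≈1 = +-cong a≈1 (-‿cong b≈1)

  -- the coefficient of the V_k-sum in the theorem: 1 for k = 1, p k for k ≥ 2
  coeff : ℕ → Carrier
  coeff zero = 0#
  coeff (suc zero) = 1#
  coeff (suc (suc k)) = p (suc (suc k))

  weight-expansion : (L : ℕ) → weight (suc L) ≈ ∑< (suc L) (λ k → coeff (suc k) * weight (L ∸ k))
  weight-expansion L = sym (begin
    1# * weight L + X                     ≈⟨ +-cong (*-identityˡ _) X≈Δweight ⟩
    weight L + (weight (suc L) - weight L) ≈⟨ x+[y-x]≈y _ _ ⟩
    weight (suc L) ∎)
    where
    X = ∑< L (λ k → p (suc (suc k)) * weight (L ∸ suc k))
    -- p 0 = p 1 = 0, so only the tail of p ⋆ weight survives
    X≈Δweight : X ≈ Δweight (suc L)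
    X≈Δweight = begin
      X                                        ≈⟨ sym (trans (+-identityˡ _) (+-identityˡ _)) ⟩
      0# + (0# + X)                            ≈⟨ sym (+-cong (zeroˡ _) (+-congʳ (trans (*-congʳ (p-below 1 (s≤s (s≤s z≤n)))) (zeroˡ _)))) ⟩
      p 0 * weight (suc L) + (p 1 * weight L + X) ≈⟨ p⋆weight (suc L) ⟩
      Δweight (suc L) ∎

  -- Split α W at the end of the first run (of length L), expand the weight
  -- of that run, and fold each term back via alpha-drop.
  pow-alpha-expansion : {n : ℕ} (x : Fin n) (w : List (Fin n)) (B : ℕ) → length (x ∷ w) ≤ B →
    pow t (alpha r (x ∷ w)) ≈
    ∑< B (λ k → coeff (suc k) * (bit (incRun (suc k) (x ∷ w)) * pow t (alpha r (drop (suc k) (x ∷ w)))))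
  pow-alpha-expansion x w B |W|≤B = begin
    pow t (alpha r W)                                         ≡⟨ Eq.cong (pow t) (alpha-run ρ W) ⟩
    pow t ((suc L ∸ r) ℕ.+ β)                                 ≈⟨ pow-+ (suc L ∸ r) β ⟩
    weight L * pow t β                                        ≈⟨ *-congʳ (weight-expansion L') ⟩
    ∑< L (λ k → coeff (suc k) * weight (L' ∸ k)) * pow t β    ≈⟨ *-comm _ _ ⟩
    pow t β * ∑< L (λ k → coeff (suc k) * weight (L' ∸ k))    ≈⟨ sym (∑<-*ˡ (pow t β) L (λ k → coeff (suc k) * weight (L' ∸ k))) ⟩
    ∑< L (λ k → pow t β * (coeff (suc k) * weight (L' ∸ k)))  ≈⟨ ∑<-cong L term ⟩
    ∑< L f                                                    ≈⟨ ∑<-extend L B f (ℕP.≤-trans (runLen≤length W) |W|≤B) beyond ⟩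
    ∑< B f ∎
    where
    W = x ∷ w
    L' = runAfter x w
    L = runLen W
    β = alpha r (drop L W)
    f : ℕ → Carrier
    f k = coeff (suc k) * (bit (incRun (suc k) W) * pow t (alpha r (drop (suc k) W)))
    beyond : (k : ℕ) → L ≤ k → f k ≈ 0#
    beyond k L≤k = trans (*-congˡ (trans (*-congʳ (reflexive (Eq.cong bit (incRun-beyond k W L≤k)))) (zeroˡ _))) (zeroʳ _)
    term : (k : ℕ) → k < L → pow t β * (coeff (suc k) * weight (L' ∸ k)) ≈ f k
    term k k<L = begin
      pow t β * (coeff (suc k) * weight (L' ∸ k))               ≈⟨ *-comm _ _ ⟩
      (coeff (suc k) * weight (L' ∸ k)) * pow t β               ≈⟨ *-assoc _ _ _ ⟩
      coeff (suc k) * (weight (L' ∸ k) * pow t β)               ≈⟨ *-congˡ (sym (pow-+ (suc (L' ∸ k) ∸ r) β)) ⟩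
      coeff (suc k) * pow t ((suc (L' ∸ k) ∸ r) ℕ.+ β)          ≡⟨ Eq.cong (λ e → coeff (suc k) * pow t e) (Eq.sym (alpha-drop ρ (suc k) W k<L)) ⟩
      coeff (suc k) * pow t (alpha r (drop (suc k) W))          ≈⟨ *-congˡ (sym (*-identityˡ _)) ⟩
      coeff (suc k) * (1# * pow t (alpha r (drop (suc k) W)))   ≡⟨ Eq.cong (λ b → coeff (suc k) * (bit b * pow t (alpha r (drop (suc k) W)))) (Eq.sym (incRun-within k W k<L)) ⟩
      f k ∎

module WordSums {c ℓ : Level} (R : CommutativeRing c ℓ) where
  open CommutativeRing R
  open Sums R
  open import Relation.Binary.Reasoning.Setoid setoid
  import Data.Bool.Properties as BoolP

  ∑words : (n N : ℕ) → (List (Fin n) → Carrier) → Carrier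
  ∑words n N F = ∑ (allWords n N) F

  ∑-allFin-suc : (n : ℕ) (F : Fin (suc n) → Carrier) →
    ∑ (List.allFin (suc n)) F ≈ F Fin.zero + ∑ (List.allFin n) (λ a → F (Fin.suc a))
  ∑-allFin-suc n F = +-congˡ (trans (reflexive (Eq.cong (λ as → ∑ as F) (Eq.sym (ListP.map-tabulate (λ a → a) Fin.suc))))
                                     (∑-map Fin.suc (List.allFin n) F))

  ∑words-suc : {n : ℕ} (N : ℕ) (F : List (Fin n) → Carrier) →
    ∑words n (suc N) F ≈ ∑words n N (λ w → ∑ (List.allFin n) (λ a → F (a ∷ w)))
  ∑words-suc {n} N F = trans (∑-concatMap (λ w → map (λ a → a ∷ w) (List.allFin n)) (allWords n N) F)
                             (∑-cong (allWords n N) (λ w → ∑-map (λ a → a ∷ w) (List.allFin n) F))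

  ∑words-cong : {n : ℕ} (N : ℕ) {F G : List (Fin n) → Carrier} →
    (∀ w → length w ≡ N → F w ≈ G w) → ∑words n N F ≈ ∑words n N G
  ∑words-cong zero F≈G = +-congʳ (F≈G [] Eq.refl)
  ∑words-cong {n} (suc N) {F} {G} F≈G = begin
    ∑words n (suc N) F                                          ≈⟨ ∑words-suc N F ⟩
    ∑words n N (λ w → ∑ (List.allFin n) (λ a → F (a ∷ w)))      ≈⟨ ∑words-cong N (λ w |w| → ∑-cong (List.allFin n) (λ a → F≈G (a ∷ w) (Eq.cong suc |w|))) ⟩
    ∑words n N (λ w → ∑ (List.allFin n) (λ a → G (a ∷ w)))      ≈⟨ sym (∑words-suc N G) ⟩
    ∑words n (suc N) G ∎

  ∑words-split : {n : ℕ} (j M : ℕ) (F : List (Fin n) → Carrier) →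
    ∑words n (j ℕ.+ M) F ≈ ∑words n j (λ u → ∑words n M (λ w → F (u ++ w)))
  ∑words-split zero M F = sym (+-identityʳ _)
  ∑words-split {n} (suc j) M F = begin
    ∑words n (suc (j ℕ.+ M)) F
      ≈⟨ ∑words-suc (j ℕ.+ M) F ⟩
    ∑words n (j ℕ.+ M) (λ w → ∑ (List.allFin n) (λ a → F (a ∷ w)))
      ≈⟨ ∑words-split j M _ ⟩
    ∑words n j (λ u → ∑words n M (λ w → ∑ (List.allFin n) (λ a → F (a ∷ (u ++ w)))))
      ≈⟨ ∑-cong (allWords n j) (λ u → ∑-swap (allWords n M) (List.allFin n) (λ w a → F (a ∷ (u ++ w)))) ⟩
    ∑words n j (λ u → ∑ (List.allFin n) (λ a → ∑words n M (λ w → F (a ∷ (u ++ w)))))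
      ≈⟨ sym (∑words-suc j (λ u → ∑words n M (λ w → F (u ++ w)))) ⟩
    ∑words n (suc j) (λ u → ∑words n M (λ w → F (u ++ w))) ∎

  -- Each letter, word and 0-1 vector is listed exactly once, so a sum
  -- against the indicator of "= x₀" picks out the value at x₀.
  ∑-allFin-delta : (n : ℕ) (a₀ : Fin n) (F : Fin n → Carrier) →
    ∑ (List.allFin n) (λ a → 𝟙 (a₀ Fin.≟ a) * F a) ≈ F a₀
  ∑-allFin-delta (suc n) Fin.zero F = begin
    ∑ (List.allFin (suc n)) (λ a → 𝟙 (Fin.zero Fin.≟ a) * F a)
      ≈⟨ ∑-allFin-suc n _ ⟩
    𝟙 (Fin.zero Fin.≟ Fin.zero {n}) * F Fin.zero + ∑ (List.allFin n) (λ a → 𝟙 (Fin.zero Fin.≟ Fin.suc a) * F (Fin.suc a))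
      ≈⟨ +-cong (trans (*-congʳ (𝟙-yes (Fin.zero Fin.≟ Fin.zero {n}) Eq.refl)) (*-identityˡ _))
                (∑-zero (List.allFin n) (λ a → trans (*-congʳ (𝟙-no (Fin.zero Fin.≟ Fin.suc a) (λ ()))) (zeroˡ _))) ⟩
    F Fin.zero + 0#
      ≈⟨ +-identityʳ _ ⟩
    F Fin.zero ∎
  ∑-allFin-delta (suc n) (Fin.suc a₀) F = begin
    ∑ (List.allFin (suc n)) (λ a → 𝟙 (Fin.suc a₀ Fin.≟ a) * F a)
      ≈⟨ ∑-allFin-suc n _ ⟩
    𝟙 (Fin.suc a₀ Fin.≟ Fin.zero) * F Fin.zero + ∑ (List.allFin n) (λ a → 𝟙 (Fin.suc a₀ Fin.≟ Fin.suc a) * F (Fin.suc a))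
      ≈⟨ +-cong (trans (*-congʳ (𝟙-no (Fin.suc a₀ Fin.≟ Fin.zero) (λ ()))) (zeroˡ _))
                (∑-cong (List.allFin n) (λ a → *-congʳ (𝟙-⇔ (Fin.suc a₀ Fin.≟ Fin.suc a) (a₀ Fin.≟ a) FinP.suc-injective (Eq.cong Fin.suc)))) ⟩
    0# + ∑ (List.allFin n) (λ a → 𝟙 (a₀ Fin.≟ a) * F (Fin.suc a))
      ≈⟨ trans (+-identityˡ _) (∑-allFin-delta n a₀ (λ a → F (Fin.suc a))) ⟩
    F (Fin.suc a₀) ∎

  _≟w_ : {n : ℕ} → (u w : List (Fin n)) → Dec (u ≡ w)
  _≟w_ = ListP.≡-dec Fin._≟_

  ∑words-delta : {n : ℕ} (u₀ : List (Fin n)) (F : List (Fin n) → Carrier) →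
    ∑words n (length u₀) (λ u → 𝟙 (u₀ ≟w u) * F u) ≈ F u₀
  ∑words-delta {n} [] F = trans (+-identityʳ _) (trans (*-congʳ (𝟙-yes (_≟w_ {n} [] []) Eq.refl)) (*-identityˡ _))
  ∑words-delta {n} (a₀ ∷ w₀) F = begin
    ∑words n (suc (length w₀)) (λ u → 𝟙 ((a₀ ∷ w₀) ≟w u) * F u)
      ≈⟨ ∑words-suc (length w₀) _ ⟩
    ∑words n (length w₀) (λ w → ∑ (List.allFin n) (λ a → 𝟙 ((a₀ ∷ w₀) ≟w (a ∷ w)) * F (a ∷ w)))
      ≈⟨ ∑-cong (allWords n (length w₀)) (λ w → ∑-cong (List.allFin n) (λ a →
           𝟙-× ((a₀ ∷ w₀) ≟w (a ∷ w)) (a₀ Fin.≟ a) (w₀ ≟w w) (F (a ∷ w))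
               ListP.∷-injectiveˡ ListP.∷-injectiveʳ (Eq.cong₂ _∷_))) ⟩
    ∑words n (length w₀) (λ w → ∑ (List.allFin n) (λ a → 𝟙 (a₀ Fin.≟ a) * (𝟙 (w₀ ≟w w) * F (a ∷ w))))
      ≈⟨ ∑-cong (allWords n (length w₀)) (λ w → ∑-allFin-delta n a₀ (λ a → 𝟙 (w₀ ≟w w) * F (a ∷ w))) ⟩
    ∑words n (length w₀) (λ w → 𝟙 (w₀ ≟w w) * F (a₀ ∷ w))
      ≈⟨ ∑words-delta w₀ (λ w → F (a₀ ∷ w)) ⟩
    F (a₀ ∷ w₀) ∎

  _≟v_ : {n : ℕ} → (v w : Vec Bool n) → Dec (v ≡ w)
  _≟v_ = VecP.≡-dec BoolP._≟_

  ∑bits-delta : (n : ℕ) (v₀ : Vec Bool n) (F : Vec Bool n → Carrier) →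
    ∑ (allBoolVecs n) (λ v → 𝟙 (v₀ ≟v v) * F v) ≈ F v₀
  ∑bits-delta zero [] F = trans (+-identityʳ _) (trans (*-congʳ (𝟙-yes ([] ≟v []) Eq.refl)) (*-identityˡ _))
  ∑bits-delta (suc n) (b₀ ∷ v₀) F = begin
    ∑ (allBoolVecs (suc n)) G
      ≈⟨ ∑-concatMap (λ v → (false ∷ v) ∷ (true ∷ v) ∷ []) (allBoolVecs n) G ⟩
    ∑ (allBoolVecs n) (λ v → G (false ∷ v) + (G (true ∷ v) + 0#))
      ≈⟨ ∑-cong (allBoolVecs n) (λ v → +-cong (split false v) (trans (+-identityʳ _) (split true v))) ⟩
    ∑ (allBoolVecs n) (λ v → 𝟙 (b₀ BoolP.≟ false) * H false v + 𝟙 (b₀ BoolP.≟ true) * H true v)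
      ≈⟨ ∑-cong (allBoolVecs n) (pick b₀) ⟩
    ∑ (allBoolVecs n) (H b₀)
      ≈⟨ ∑bits-delta n v₀ (λ v → F (b₀ ∷ v)) ⟩
    F (b₀ ∷ v₀) ∎
    where
    G : Vec Bool (suc n) → Carrier
    G v = 𝟙 ((b₀ ∷ v₀) ≟v v) * F v
    H : Bool → Vec Bool n → Carrier
    H b v = 𝟙 (v₀ ≟v v) * F (b ∷ v)
    split : (b : Bool) (v : Vec Bool n) → G (b ∷ v) ≈ 𝟙 (b₀ BoolP.≟ b) * H b v
    split b v = 𝟙-× ((b₀ ∷ v₀) ≟v (b ∷ v)) (b₀ BoolP.≟ b) (v₀ ≟v v) (F (b ∷ v))
                    VecP.∷-injectiveˡ VecP.∷-injectiveʳ (Eq.cong₂ _∷_)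
    pick : (b₀ : Bool) (v : Vec Bool n) → 𝟙 (b₀ BoolP.≟ false) * H false v + 𝟙 (b₀ BoolP.≟ true) * H true v ≈ H b₀ v
    pick false v = trans (+-cong (*-identityˡ _) (zeroˡ _)) (+-identityʳ _)
    pick true v = trans (+-cong (zeroˡ _) (*-identityˡ _)) (+-identityˡ _)

module Recursion {c ℓ : Level} (R : CommutativeRing c ℓ) (n ρ : ℕ) (t : CommutativeRing.Carrier R) (m : Vec ℕ n) where
  open CommutativeRing R
  open Poly R
  open Sums R
  open WordSums R
  open Coefficients R ρ t
  open import Relation.Binary.Reasoning.Setoid setoid

  N : ℕ
  N = sumℕ m

  _≟c_ : (x y : Vec ℕ n) → Dec (x ≡ y)
  _≟c_ = VecP.≡-dec ℕ._≟_

  powα : List (Fin n) → Carrier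
  powα w = pow t (alpha r w)

  g- : Vec ℕ n → Carrier
  g- x = gℤ r (m -ᵥ x) t

  T : ℕ → Carrier
  T k = ∑ (V n k) (λ v → gℤ r (minus m v) t)

  inc : List (Fin n) → Carrier
  inc u = bit (incRun (length u) u)

  g-words : g r m t ≈ ∑words n N (λ w → 𝟙 (content w ≟c m) * powα w)
  g-words = ∑-filter (λ w → content w ≟c m) (allWords n N) powα

  -- Completing a prefix u to a word of content m: the completions are the
  -- words of content m - content u, so they sum to g(m - content u)
  -- (which is 0 when m - content u has a negative entry).
  completions : (u : List (Fin n)) →
    ∑words n (N ∸ length u) (λ w → 𝟙 (content (u ++ w) ≟c m) * powα w) ≈ g- (content u)
  completions u with natVec? (m -ᵥ content u) in remainder
  ... | just m' = begin
    ∑words n (N ∸ length u) (λ w → 𝟙 (content (u ++ w) ≟c m) * powα w)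
      ≡⟨ Eq.cong (λ M → ∑words n M (λ w → 𝟙 (content (u ++ w) ≟c m) * powα w)) N-|u| ⟩
    ∑words n (sumℕ m') (λ w → 𝟙 (content (u ++ w) ≟c m) * powα w)
      ≈⟨ ∑-cong (allWords n (sumℕ m')) (λ w → *-congʳ (𝟙-⇔ (content (u ++ w) ≟c m) (content w ≟c m')
           (λ e → +ᵥ-cancelˡ (content u) (content w) m' (Eq.trans (Eq.sym (content-++ u w)) (Eq.trans e m≡u+m')))
           (λ e → Eq.trans (content-++ u w) (Eq.trans (Eq.cong (content u +ᵥ_) e) (Eq.sym m≡u+m'))))) ⟩
    ∑words n (sumℕ m') (λ w → 𝟙 (content w ≟c m') * powα w)
      ≈⟨ sym (∑-filter (λ w → content w ≟c m') (allWords n (sumℕ m')) powα) ⟩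
    g r m' t ∎
    where
    m≡u+m' : m ≡ content u +ᵥ m'
    m≡u+m' = natVec?-minus-just m (content u) m' remainder
    N-|u| : N ∸ length u ≡ sumℕ m'
    N-|u| = Eq.trans (Eq.cong (_∸ length u) (Eq.trans (Eq.cong sumℕ m≡u+m')
              (Eq.trans (sumℕ-+ᵥ (content u) m') (Eq.cong (ℕ._+ sumℕ m') (sumℕ-content u)))))
              (ℕP.m+n∸m≡n (length u) (sumℕ m'))
  ... | nothing = ∑-zero (allWords n (N ∸ length u)) (λ w → trans (*-congʳ (𝟙-no (content (u ++ w) ≟c m) (impossible w))) (zeroˡ _))
    where
    impossible : (w : List (Fin n)) → ¬ content (u ++ w) ≡ m
    impossible w e with Eq.trans (Eq.sym remainder)
      (Eq.subst (λ z → natVec? (z -ᵥ content u) ≡ just (content w)) (Eq.trans (Eq.sym (content-++ u w)) e)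
                (natVec?-minus-sum (content u) (content w)))
    ... | ()

  count-increasing : (j : ℕ) (v : Vec Bool n) →
    ∑words n j (λ u → inc u * 𝟙 (content u ≟c bits v)) ≈ 𝟙 (ones v ℕ.≟ j)
  count-increasing j v with ones v ℕ.≟ j
  ... | yes ones≡j = begin
    ∑words n j (λ u → inc u * 𝟙 (content u ≟c bits v))
      ≈⟨ ∑words-cong j (λ u _ → trans (only-incWord u) (sym (*-identityʳ _))) ⟩
    ∑words n j (λ u → 𝟙 (incWord v ≟w u) * 1#)
      ≡⟨ Eq.cong (λ k → ∑words n k (λ u → 𝟙 (incWord v ≟w u) * 1#)) (Eq.sym (Eq.trans (length-incWord v) ones≡j)) ⟩
    ∑words n (length (incWord v)) (λ u → 𝟙 (incWord v ≟w u) * 1#)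
      ≈⟨ ∑words-delta (incWord v) (λ _ → 1#) ⟩
    1# ∎
    where
    only-incWord : (u : List (Fin n)) → inc u * 𝟙 (content u ≟c bits v) ≈ 𝟙 (incWord v ≟w u)
    only-incWord u with incRun (length u) u in increasing
    ... | false = trans (zeroˡ _) (sym (𝟙-no (incWord v ≟w u) (λ e → false≢true (Eq.trans (Eq.sym increasing)
                    (Eq.subst Increasing e (incWord-increasing v))))))
      where
      false≢true : ¬ false ≡ true
      false≢true ()
    ... | true = trans (*-identityˡ _) (𝟙-⇔ (content u ≟c bits v) (incWord v ≟w u)
                   (λ e → increasing-unique (incWord v) u (incWord-increasing v) increasing (Eq.trans (content-incWord v) (Eq.sym e)))
                   (λ e → Eq.trans (Eq.cong content (Eq.sym e)) (content-incWord v)))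
  ... | no ones≢j = trans (∑words-cong j wrong-length) (∑-zero (allWords n j) (λ _ → refl))
    where
    wrong-length : (u : List (Fin n)) → length u ≡ j → inc u * 𝟙 (content u ≟c bits v) ≈ 0#
    wrong-length u |u|≡j = trans (*-congˡ (𝟙-no (content u ≟c bits v)
      (λ e → ones≢j (Eq.trans (Eq.sym (sumℕ-bits v)) (Eq.trans (Eq.cong sumℕ (Eq.sym e)) (Eq.trans (sumℕ-content u) |u|≡j))))))
      (zeroʳ _)

  content-as-bits : (u : List (Fin n)) →
    ∑ (allBoolVecs n) (λ v → inc u * (𝟙 (content u ≟c bits v) * g- (bits v))) ≈ inc u * g- (content u)
  content-as-bits u with incRun (length u) u in increasing
  ... | false = trans (∑-zero (allBoolVecs n) (λ _ → zeroˡ _)) (sym (zeroˡ _))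
  ... | true with increasing-bits u increasing
  ...   | v₀ , content≡bits = begin
    ∑ (allBoolVecs n) (λ v → 1# * (𝟙 (content u ≟c bits v) * g- (bits v)))
      ≈⟨ ∑-cong (allBoolVecs n) (λ v → trans (*-identityˡ _) (*-congʳ (𝟙-⇔ (content u ≟c bits v) (v₀ ≟v v)
           (λ e → bits-injective v₀ v (Eq.trans (Eq.sym content≡bits) e)) (λ e → Eq.trans content≡bits (Eq.cong bits e))))) ⟩
    ∑ (allBoolVecs n) (λ v → 𝟙 (v₀ ≟v v) * g- (bits v))
      ≈⟨ ∑bits-delta n v₀ (λ v → g- (bits v)) ⟩
    g- (bits v₀)
      ≡⟨ Eq.cong g- (Eq.sym content≡bits) ⟩
    g- (content u)
      ≈⟨ sym (*-identityˡ _) ⟩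
    1# * g- (content u) ∎

  T-increasing : (j : ℕ) → T j ≈ ∑words n j (λ u → inc u * g- (content u))
  T-increasing j = begin
    T j
      ≈⟨ ∑-filter (λ v → ones v ℕ.≟ j) (allBoolVecs n) (λ v → gℤ r (minus m v) t) ⟩
    ∑ (allBoolVecs n) (λ v → 𝟙 (ones v ℕ.≟ j) * gℤ r (minus m v) t)
      ≈⟨ ∑-cong (allBoolVecs n) (λ v → *-cong (sym (count-increasing j v)) (reflexive (Eq.cong (λ z → gℤ r z t) (minus-bits m v)))) ⟩
    ∑ (allBoolVecs n) (λ v → ∑words n j (λ u → inc u * 𝟙 (content u ≟c bits v)) * g- (bits v))
      ≈⟨ ∑-cong (allBoolVecs n) (λ v → trans (*-comm _ _) (trans (sym (∑-*ˡ (g- (bits v)) (allWords n j) _))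
           (∑-cong (allWords n j) (λ u → trans (*-comm _ _) (*-assoc _ _ _))))) ⟩
    ∑ (allBoolVecs n) (λ v → ∑words n j (λ u → inc u * (𝟙 (content u ≟c bits v) * g- (bits v))))
      ≈⟨ ∑-swap (allBoolVecs n) (allWords n j) (λ v u → inc u * (𝟙 (content u ≟c bits v) * g- (bits v))) ⟩
    ∑words n j (λ u → ∑ (allBoolVecs n) (λ v → inc u * (𝟙 (content u ≟c bits v) * g- (bits v))))
      ≈⟨ ∑-cong (allWords n j) content-as-bits ⟩
    ∑words n j (λ u → inc u * g- (content u)) ∎

  runTerm : ℕ → List (Fin n) → Carrier
  runTerm k w = 𝟙 (content w ≟c m) * (bit (incRun (suc k) w) * powα (drop (suc k) w))

  -- Summing the k-th term over all words: split each word after its first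
  -- k+1 letters; the prefix must be increasing and the suffix is a
  -- completion, so the sum is T (k+1).
  ∑runTerm : (k : ℕ) → k < N → ∑words n N (runTerm k) ≈ T (suc k)
  ∑runTerm k k<N = begin
    ∑words n N (runTerm k)
      ≡⟨ Eq.cong (λ K → ∑words n K (runTerm k)) (Eq.sym (ℕP.m+[n∸m]≡n k<N)) ⟩
    ∑words n (suc k ℕ.+ M) (runTerm k)
      ≈⟨ ∑words-split (suc k) M (runTerm k) ⟩
    ∑words n (suc k) (λ u → ∑words n M (λ w → runTerm k (u ++ w)))
      ≈⟨ ∑words-cong (suc k) prefix ⟩
    ∑words n (suc k) (λ u → inc u * g- (content u))
      ≈⟨ sym (T-increasing (suc k)) ⟩
    T (suc k) ∎
    where
    M = N ∸ suc k
    prefix : (u : List (Fin n)) → length u ≡ suc k → ∑words n M (λ w → runTerm k (u ++ w)) ≈ inc u * g- (content u)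
    prefix u |u|≡1+k = begin
      ∑words n M (λ w → runTerm k (u ++ w))
        ≈⟨ ∑-cong (allWords n M) (λ w → trans (reflexive (Eq.cong₂ (λ b z → 𝟙 (content (u ++ w) ≟c m) * (bit b * powα z))
             (Eq.trans (incRun-prefix (suc k) u w |u|≡1+k) (Eq.cong (λ j → incRun j u) (Eq.sym |u|≡1+k)))
             (Eq.trans (Eq.cong (λ j → drop j (u ++ w)) (Eq.sym |u|≡1+k)) (drop-++ u w))))
             (x∙yz≈y∙xz _ _ _)) ⟩
      ∑words n M (λ w → inc u * (𝟙 (content (u ++ w) ≟c m) * powα w))
        ≈⟨ ∑-*ˡ (inc u) (allWords n M) _ ⟩
      inc u * ∑words n M (λ w → 𝟙 (content (u ++ w) ≟c m) * powα w)
        ≡⟨ Eq.cong (λ j → inc u * ∑words n (N ∸ j) (λ w → 𝟙 (content (u ++ w) ≟c m) * powα w)) (Eq.sym |u|≡1+k) ⟩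
      inc u * ∑words n (N ∸ length u) (λ w → 𝟙 (content (u ++ w) ≟c m) * powα w)
        ≈⟨ *-congˡ (completions u) ⟩
      inc u * g- (content u) ∎
      where
      open import Algebra.Properties.CommutativeSemigroup *-commutativeSemigroup using (x∙yz≈y∙xz)

  -- Expanding t^{α w} for every word of content m (all nonempty, as m ≠ 0)
  -- and summing term by term:  g(m) = ∑_{k<N} coeff (k+1) · T (k+1).
  g-expansion : ¬ m ≡ replicate n 0 → g r m t ≈ ∑< N (λ k → coeff (suc k) * T (suc k))
  g-expansion m≢0 = begin
    g r m t
      ≈⟨ g-words ⟩
    ∑words n N (λ w → 𝟙 (content w ≟c m) * powα w)
      ≈⟨ ∑words-cong N expand ⟩
    ∑words n N (λ w → ∑< N (λ k → coeff (suc k) * runTerm k w))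
      ≈⟨ sym (∑<-∑-swap N (allWords n N) (λ k w → coeff (suc k) * runTerm k w)) ⟩
    ∑< N (λ k → ∑words n N (λ w → coeff (suc k) * runTerm k w))
      ≈⟨ ∑<-cong N (λ k k<N → trans (∑-*ˡ (coeff (suc k)) (allWords n N) (runTerm k)) (*-congˡ (∑runTerm k k<N))) ⟩
    ∑< N (λ k → coeff (suc k) * T (suc k)) ∎
    where
    expand : (w : List (Fin n)) → length w ≡ N → 𝟙 (content w ≟c m) * powα w ≈ ∑< N (λ k → coeff (suc k) * runTerm k w)
    expand w _ with content w ≟c m
    ... | no _ = trans (zeroˡ _) (sym (∑<-zero N (λ k _ → trans (*-congˡ (zeroˡ _)) (zeroʳ _))))
    expand [] _ | yes content≡m = ⊥-elim (m≢0 (Eq.sym content≡m))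
    expand (x ∷ w) |w|≡N | yes _ = begin
      1# * powα (x ∷ w)
        ≈⟨ *-identityˡ _ ⟩
      powα (x ∷ w)
        ≈⟨ pow-alpha-expansion x w N (ℕP.≤-reflexive |w|≡N) ⟩
      ∑< N (λ k → coeff (suc k) * (bit (incRun (suc k) (x ∷ w)) * powα (drop (suc k) (x ∷ w))))
        ≈⟨ ∑<-cong N (λ k _ → *-congˡ (sym (*-identityˡ _))) ⟩
      ∑< N (λ k → coeff (suc k) * (1# * (bit (incRun (suc k) (x ∷ w)) * powα (drop (suc k) (x ∷ w))))) ∎

  -- Regrouping: the k = 0 term is T 1, and p 0 = p 1 = 0 lets the other
  -- terms be written as ∑_{k ≤ K} p k · T k.
  regroup : (K : ℕ) → 1 ≤ K → ∑< K (λ k → coeff (suc k) * T (suc k)) ≈ T 1 + ∑< (suc K) (λ k → p k * T k)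
  regroup (suc K) _ = +-cong (*-identityˡ (T 1)) (sym (begin
    p 0 * T 0 + (p 1 * T 1 + X) ≈⟨ +-cong (pT-below 0 (s≤s z≤n)) (+-congʳ (pT-below 1 (s≤s (s≤s z≤n)))) ⟩
    0# + (0# + X)               ≈⟨ trans (+-identityˡ _) (+-identityˡ _) ⟩
    X ∎))
    where
    X = ∑< K (λ k → p (suc (suc k)) * T (suc (suc k)))
    pT-below : (k : ℕ) → k < r → p k * T k ≈ 0#
    pT-below k k<r = trans (*-congʳ (p-below k k<r)) (zeroˡ _)

  -- V_k is empty for k > n ...
  T-beyond-n : (k : ℕ) → n < k → T k ≈ 0#
  T-beyond-n k n<k = trans (∑-filter (λ v → ones v ℕ.≟ k) (allBoolVecs n) (λ v → gℤ r (minus m v) t))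
    (∑-zero (allBoolVecs n) (λ v → trans (*-congʳ (𝟙-no (ones v ℕ.≟ k)
      (λ ones≡k → ℕP.<-irrefl Eq.refl (ℕP.≤-<-trans (Eq.subst (_≤ n) ones≡k (ones≤length v)) n<k)))) (zeroˡ _)))

  -- ... and m - v has a negative entry when v has more than N ones.
  T-beyond-N : (k : ℕ) → N < k → T k ≈ 0#
  T-beyond-N k N<k = trans (∑-filter (λ v → ones v ℕ.≟ k) (allBoolVecs n) (λ v → gℤ r (minus m v) t))
    (∑-zero (allBoolVecs n) (λ v → vanish v (ones v ℕ.≟ k)))
    where
    g-beyond : (x : Vec ℕ n) → N < sumℕ x → g- x ≈ 0#
    g-beyond x N<|x| with natVec? (m -ᵥ x) in remainder
    ... | nothing = refl
    ... | just m' = ⊥-elim (ℕP.<-irrefl Eq.refl (ℕP.<-≤-trans N<|x| (Eq.subst (sumℕ x ≤_) (Eq.sym N≡) (ℕP.m≤m+n (sumℕ x) (sumℕ m')))))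
      where
      N≡ : N ≡ sumℕ x ℕ.+ sumℕ m'
      N≡ = Eq.trans (Eq.cong sumℕ (natVec?-minus-just m x m' remainder)) (sumℕ-+ᵥ x m')
    vanish : (v : Vec Bool n) (d : Dec (ones v ≡ k)) → 𝟙 d * gℤ r (minus m v) t ≈ 0#
    vanish v (no _) = zeroˡ _
    vanish v (yes ones≡k) = trans (*-identityˡ _) (trans (reflexive (Eq.cong (λ z → gℤ r z t) (minus-bits m v)))
      (g-beyond (bits v) (Eq.subst (N <_) (Eq.sym (Eq.trans (sumℕ-bits v) ones≡k)) N<k)))

  range-sum : ∑ (range r n) (λ k → ∑ (V n k) (λ v → p k * gℤ r (minus m v) t)) ≈ ∑< (r ℕ.+ (suc n ∸ r)) (λ k → p k * T k)
  range-sum = begin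
    ∑ (range r n) (λ k → ∑ (V n k) (λ v → p k * gℤ r (minus m v) t))
      ≈⟨ ∑-cong (range r n) (λ k → ∑-*ˡ (p k) (V n k) (λ v → gℤ r (minus m v) t)) ⟩
    ∑ (range r n) pT
      ≈⟨ trans (∑-map (r ℕ.+_) (List.upTo (suc n ∸ r)) pT) (∑-upTo (suc n ∸ r) (λ i → pT (r ℕ.+ i))) ⟩
    ∑< (suc n ∸ r) (λ i → pT (r ℕ.+ i))
      ≈⟨ sym (trans (+-congʳ (∑<-zero {pT} r (λ k k<r → trans (*-congʳ (p-below k k<r)) (zeroˡ _)))) (+-identityˡ _)) ⟩
    ∑< r pT + ∑< (suc n ∸ r) (λ i → pT (r ℕ.+ i))
      ≈⟨ sym (∑<-split r (suc n ∸ r) pT) ⟩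
    ∑< (r ℕ.+ (suc n ∸ r)) pT ∎
    where
    pT : ℕ → Carrier
    pT k = p k * T k

  N-positive : ¬ m ≡ replicate n 0 → 1 ≤ N
  N-positive m≢0 = ℕP.n≢0⇒n>0 (λ N≡0 → m≢0 (sumℕ≡0 m N≡0))

mainTheorem2 : {c ℓ : Level} (R : CommutativeRing c ℓ) (n r : ℕ) → 1 ≤ n → 2 ≤ r →
    (m : Vec ℕ n) → ¬ (m ≡ replicate n 0) → (t : CommutativeRing.Carrier R) →
    let open CommutativeRing R
        open Poly R
    in g r m t ≈
       sumR (map (λ v → gℤ r (minus m v) t) (V n 1))
       + sumR (map (λ k → sumR (map (λ v → P r k t * gℤ r (minus m v) t) (V n k)))
                   (range r n))
mainTheorem2 R n (suc (suc ρ)) _ (s≤s (s≤s z≤n)) m m≢0 t = begin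
  g r m t                                 ≈⟨ g-expansion m≢0 ⟩
  ∑< N (λ k → coeff (suc k) * T (suc k))  ≈⟨ regroup N (N-positive m≢0) ⟩
  T 1 + ∑< (suc N) pT                     ≈⟨ +-congˡ (∑<-extend (suc N) B pT (ℕP.m≤n+m (suc N) A) (vanishing (suc N) T-beyond-N)) ⟩
  T 1 + ∑< B pT                           ≈⟨ +-congˡ (sym (∑<-extend A B pT (ℕP.m≤m+n A (suc N)) (vanishing A (λ k A≤k → T-beyond-n k (ℕP.≤-trans n<A A≤k))))) ⟩
  T 1 + ∑< A pT                           ≈⟨ +-congˡ (sym range-sum) ⟩
  T 1 + ∑ (range r n) (λ k → ∑ (V n k) (λ v → p k * gℤ r (minus m v) t)) ∎
  where
  open CommutativeRing R
  open Poly R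
  open Sums R
  open Coefficients R ρ t
  open Recursion R n ρ t m
  open import Relation.Binary.Reasoning.Setoid setoid
  -- A is the end of the range r, …, n; B exceeds both A and N + 1
  A B : ℕ
  A = r ℕ.+ (suc n ∸ r)
  B = A ℕ.+ suc N
  pT : ℕ → Carrier
  pT k = p k * T k
  vanishing : (K : ℕ) → (∀ k → K ≤ k → T k ≈ 0#) → ∀ k → K ≤ k → pT k ≈ 0#
  vanishing K T≈0 k K≤k = trans (*-congˡ (T≈0 k K≤k)) (zeroʳ _)
  n<A : suc n ≤ A
  n<A = ℕP.m≤n+m∸n (suc n) r
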